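{- Let $L$ be a complete lattice, let $f\in\mathrm{FinAdd}_L$ be locally $^*$-closed and let $v\in\mathrm{FinAdd}_{L,\mathbf 2}$ be $\top$-continuous. If $x\in L$ satisfies $xf^*v=\top$, then there exists $k\ge0$ such that $xf^kv=\top$.
   Context: Functions are written on the right and composed left to right: $xf$ is $f$ applied to $x$, $fv$ means "first $f$, then $v$". $\mathbf 2=\{\bot,\top\}$, $\bot<\top$. For complete lattices $L,L'$, $f:L\to L'$ is finitely additive if $\bot f=\bot$ and $(x\vee y)f=xf\vee yf$; $\mathrm{FinAdd}_{L,L'}$ is the set of these, ordered pointwise; $\mathrm{FinAdd}_L=\mathrm{FinAdd}_{L,L}$. $f^0=\mathrm{id}$, $f^{n+1}=f^nf$, $f^*=\bigvee_{n\ge0}f^n$ (pointwise). $v\in\mathrm{FinAdd}_{L,L'}$ is $\top$-continuous if $v$ is the constant $\bot$ map or for every $X\subseteq L$ with $\bigvee X=\top$, $\bigvee_{x\in X}xv=\top$. $f\in\mathrm{FinAdd}_L$ is locally $^*$-closed if for each $x\in L$ either $xf^*=\top$ or there is $N\ge0$ with $xf^*=x\vee xf\vee\dots\vee xf^N$. -}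

module Defs where

open import Level using (Level; suc; _⊔_; Lift)
open import Data.Bool using (Bool; true; false) renaming (_∨_ to _∨ᵇ_)
open import Data.Nat using (ℕ; zero) renaming (suc to sucℕ)
open import Data.Product using (Σ; ∃; _,_; _×_)
open import Data.Sum using (_⊎_)
open import Data.Empty.Polymorphic using (⊥)
open import Data.Unit.Polymorphic using (⊤)
open import Relation.Binary.PropositionalEquality using (_≡_)
open import Relation.Binary.Structures using (IsPartialOrder)

record CompleteLattice (c ℓ : Level) : Set (suc (c ⊔ ℓ)) where
  field
    Carrier        : Set c
    _≤_            : Carrier → Carrier → Set ℓ
    isPartialOrder : IsPartialOrder _≡_ _≤_
    ⋁              : (Carrier → Set c) → Carrier
    ⋁-upper        : (X : Carrier → Set c) (x : Carrier) → X x → x ≤ ⋁ X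
    ⋁-least        : (X : Carrier → Set c) (u : Carrier) →
                     ((x : Carrier) → X x → x ≤ u) → ⋁ X ≤ u

  ⊥L : Carrier
  ⊥L = ⋁ (λ _ → ⊥)

  ⊤L : Carrier
  ⊤L = ⋁ (λ _ → ⊤)

  _∨_ : Carrier → Carrier → Carrier
  x ∨ y = ⋁ (λ z → (z ≡ x) ⊎ (z ≡ y))

module _ {c ℓ : Level} (L : CompleteLattice c ℓ) where
  open CompleteLattice L

  -- f ∈ FinAdd_L  (functions written on the right: x f = f x)
  IsFinAdd : (Carrier → Carrier) → Set c
  IsFinAdd f = (f ⊥L ≡ ⊥L) × ((x y : Carrier) → f (x ∨ y) ≡ f x ∨ f y)

  -- v ∈ FinAdd_{L,2}, with 2 = Bool (false = ⊥, true = ⊤, join = _∨ᵇ_)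
  IsFinAdd₂ : (Carrier → Bool) → Set c
  IsFinAdd₂ v = (v ⊥L ≡ false) × ((x y : Carrier) → v (x ∨ y) ≡ (v x ∨ᵇ v y))

  pow : (Carrier → Carrier) → ℕ → Carrier → Carrier
  pow f zero     x = x
  pow f (sucℕ n) x = f (pow f n x)

  star : (Carrier → Carrier) → Carrier → Carrier
  star f x = ⋁ (λ y → ∃ λ n → y ≡ pow f n x)

  partialJoin : (Carrier → Carrier) → ℕ → Carrier → Carrier
  partialJoin f zero     x = x
  partialJoin f (sucℕ N) x = partialJoin f N x ∨ pow f (sucℕ N) x

  LocallyStarClosed : (Carrier → Carrier) → Set c
  LocallyStarClosed f = (x : Carrier) →
    (star f x ≡ ⊤L) ⊎ (∃ λ N → star f x ≡ partialJoin f N x)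

  -- ⊤-continuity of v : L → 2.  In 2, ⋁_{x∈X} x v = ⊤ holds exactly when
  -- some x ∈ X has x v = ⊤ (this is the literal meaning of a join in 2).
  TopContinuous : (Carrier → Bool) → Set (suc c)
  TopContinuous v =
    ((x : Carrier) → v x ≡ false) ⊎
    ((X : Carrier → Set c) → ⋁ X ≡ ⊤L → ∃ λ x → X x × (v x ≡ true))

module Submission where

-- Local *-closedness splits the argument into two cases for
-- the element x f^*.
--   * x f^* = x ∨ x f ∨ … ∨ x f^N.  A finitely additive v : L → 2 turns a
--     finite join into a Boolean disjunction, so some x f^k with k ≤ N
--     already has value ⊤  (lemma partialJoin-witness).
--   * x f^* = ⊤.  Then x f^* = ⋁ {x f^n | n ≥ 0} is a family with join ⊤,
--     v is not the constant ⊥ map (it sends x f^* to ⊤), so ⊤-continuity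
--     yields a member x f^k of the family with value ⊤
--     (lemma topContinuous-witness).

open import Defs
open import Level using (Level)
open import Data.Bool using (Bool; true; false) renaming (_∨_ to _∨ᵇ_)
open import Data.Nat using (ℕ; zero; suc)
open import Data.Product using (∃; _×_; _,_; proj₂)
open import Data.Sum using (_⊎_; inj₁; inj₂)
open import Relation.Binary.PropositionalEquality
  using (_≡_; refl; sym; trans; subst)

∨ᵇ-true : (a b : Bool) → (a ∨ᵇ b) ≡ true → (a ≡ true) ⊎ (b ≡ true)
∨ᵇ-true true  _ _ = inj₁ refl
∨ᵇ-true false _ b≡true = inj₂ b≡true

module _ {c ℓ : Level} (L : CompleteLattice c ℓ) where
  open CompleteLattice L

  Holds : (Carrier → Bool) → Carrier → Set
  Holds v y = v y ≡ true

  holds-≡ : (v : Carrier → Bool) {y z : Carrier} → y ≡ z → Holds v y → Holds v z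
  holds-≡ v = subst (Holds v)

  partialJoin-witness :
    (f : Carrier → Carrier) (v : Carrier → Bool) →
    ((y z : Carrier) → v (y ∨ z) ≡ (v y ∨ᵇ v z)) →
    (x : Carrier) (N : ℕ) → Holds v (partialJoin L f N x) →
    ∃ λ k → Holds v (pow L f k x)
  partialJoin-witness f v v-∨ x zero    holds = zero , holds
  partialJoin-witness f v v-∨ x (suc N) holds
    with ∨ᵇ-true (v (partialJoin L f N x)) (v (pow L f (suc N) x))
                 (trans (sym (v-∨ (partialJoin L f N x) (pow L f (suc N) x))) holds)
  ... | inj₁ holdsPrefix = partialJoin-witness f v v-∨ x N holdsPrefix
  ... | inj₂ holdsLast   = suc N , holdsLast

  -- A ⊤-continuous v that sends ⊤ to ⊤ sends some member of every family
  -- with join ⊤ to ⊤: the alternative "v is constantly ⊥" is refuted by v ⊤.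
  topContinuous-witness :
    (v : Carrier → Bool) → TopContinuous L v → Holds v ⊤L →
    (X : Carrier → Set c) → ⋁ X ≡ ⊤L → ∃ λ y → X y × Holds v y
  topContinuous-witness v (inj₁ constFalse) holdsTop X _
    with trans (sym (constFalse ⊤L)) holdsTop
  ... | ()
  topContinuous-witness v (inj₂ continuous) _ X ⋁X≡⊤ = continuous X ⋁X≡⊤

mainTheorem13 : {c ℓ : Level} (L : CompleteLattice c ℓ)
    (f : CompleteLattice.Carrier L → CompleteLattice.Carrier L)
    (v : CompleteLattice.Carrier L → Bool) →
    IsFinAdd L f → LocallyStarClosed L f →
    IsFinAdd₂ L v → TopContinuous L v →
    (x : CompleteLattice.Carrier L) → v (star L f x) ≡ true →
    ∃ λ k → v (pow L f k x) ≡ true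
mainTheorem13 L f v _ starClosed v-finAdd v-cont x holdsStar
  with starClosed x
... | inj₂ (N , star≡partial) =
  partialJoin-witness L f v (proj₂ v-finAdd) x N
    (holds-≡ L v star≡partial holdsStar)
... | inj₁ star≡⊤
  with topContinuous-witness L v v-cont (holds-≡ L v star≡⊤ holdsStar)
         (λ y → ∃ λ n → y ≡ pow L f n x) star≡⊤
...   | y , (k , y≡fᵏx) , holdsY = k , holds-≡ L v y≡fᵏx holdsY
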